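{- Fix a theory $\Sigma$ of directed first-order logic and polarized contexts. For all contexts $\Theta,\Delta,\Gamma$, let $\Delta_1,\Delta_2$ be two disjoint copies of $\Delta$ (fresh variable names). The map \[ \{[\Theta,\Delta_1 \mid \bullet \mid \Gamma,\Delta_2]\ \varphi\ \mathsf{prop}\} \longrightarrow \{[\Theta \mid \Delta \mid \Gamma]\ \varphi\ \mathsf{prop}\} \] which sends a formula to the formula obtained by replacing every variable of $\Delta_1$ and every variable of $\Delta_2$ by the corresponding variable of $\Delta$ (the full dinatural collapse) is well defined and is a bijection. In particular there is a bijection $\{[\Theta\mid\Delta\mid\Gamma]\ \varphi\ \mathsf{prop}\} \cong \{[\Theta,\Delta \mid \bullet \mid \Gamma,\Delta]\ \varphi\ \mathsf{prop}\}$, i.e. the syntactic doctrine $\mathsf{Syn}(\Sigma)$ satisfies the no-dinatural-variance condition.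
   Context: A theory provides: a set $\Sigma_B$ of base types; types are generated by base types, $\top$, $A\times B$, $A\Rightarrow B$; contexts are finite lists of typed variables, $\bullet$ is the empty context, and $\Theta,\Delta$ denotes concatenation. A set $\Sigma_F$ of function symbols with types $\mathsf{dom}(f),\mathsf{cod}(f)$; terms $\Gamma \vdash t : A$ are those of the simply typed $\lambda$-calculus with unit, products and functions (variables, $f(t)$ for $\Gamma\vdash t:\mathsf{dom}(f)$, $!$, pairs, projections, application, $\lambda$-abstraction). A set $\Sigma_P$ of predicate symbols with types $\mathsf{neg}(P),\mathsf{pos}(P)$. A polarized context is a triple $[\Theta\mid\Delta\mid\Gamma]$ of contexts (negative, dinatural, positive variables). For a polarity $p\in\{ -,\Delta,+\}$, $[\Theta\mid\Delta\mid\Gamma],[x:^pA]$ denotes the polarized context with $x:A$ appended to $\Theta$, $\Delta$ or $\Gamma$ respectively. Formulas $[\Theta\mid\Delta\mid\Gamma]\ \varphi\ \mathsf{prop}$ are the syntax trees (up to renaming of bound variables) generated by: $\top$ in any polarized context; $\psi\wedge\varphi$ from $[\Theta\mid\Delta\mid\Gamma]\ \psi$ and $[\Theta\mid\Delta\mid\Gamma]\ \varphi$; $\psi\Rightarrow\varphi$ in $[\Theta\mid\Delta\mid\Gamma]$ from $[\Gamma\mid\Delta\mid\Theta]\ \psi$ (negative and positive contexts swapped) and $[\Theta\mid\Delta\mid\Gamma]\ \varphi$; $s\le_A t$ from terms $\Theta,\Delta\vdash s:A$ and $\Gamma,\Delta\vdash t:A$; $P(s\mid t)$ for $P\in\Sigma_P$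 from $\Theta,\Delta\vdash s:\mathsf{neg}(P)$ and $\Gamma,\Delta\vdash t:\mathsf{pos}(P)$; and $\exists^p x.\varphi$, $\forall^p x.\varphi$ in $[\Theta\mid\Delta\mid\Gamma]$ from $[\Theta\mid\Delta\mid\Gamma],[x:^pA]\ \varphi$, for $p\in\{ -,\Delta,+\}$. The renaming map in the claim acts on the subformulas of an implication's left side with the roles of the negative and positive contexts swapped accordingly. -}

module Defs where

open import Data.Sum using (_⊎_; inj₁; inj₂; [_,_]; map)
open import Function using (id)

data Ty (B : Set) : Set where
  base : B → Ty B
  𝟙    : Ty B
  _⊗_  : Ty B → Ty B → Ty B
  _⇛_  : Ty B → Ty B → Ty B

record Theory : Set₁ where
  field
    BaseTy : Set
    Fun    : Set
    dom    : Fun → Ty BaseTy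
    cod    : Fun → Ty BaseTy
    Pred   : Set
    neg    : Pred → Ty BaseTy
    pos    : Pred → Ty BaseTy

module _ (T : Theory) where
  open Theory T

  Type : Set
  Type = Ty BaseTy

  -- Contexts: finite lists of typed variables (extended on the right);
  -- variables are de Bruijn indices, so formulas are taken up to
  -- renaming of bound variables and distinct context entries are
  -- automatically distinct ("fresh") variables.
  data Ctx : Set where
    ∙   : Ctx
    _▸_ : Ctx → Type → Ctx

  infixl 5 _▸_ _++_

  _++_ : Ctx → Ctx → Ctx
  Θ ++ ∙       = Θ
  Θ ++ (Δ ▸ A) = (Θ ++ Δ) ▸ A

  data _∋_ : Ctx → Type → Set where
    ze : ∀ {Γ A}   → (Γ ▸ A) ∋ A
    su : ∀ {Γ A B} → Γ ∋ A → (Γ ▸ B) ∋ A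

  data Tm (Γ : Ctx) : Type → Set where
    var  : ∀ {A} → Γ ∋ A → Tm Γ A
    fun  : (f : Fun) → Tm Γ (dom f) → Tm Γ (cod f)
    !    : Tm Γ 𝟙
    pair : ∀ {A B} → Tm Γ A → Tm Γ B → Tm Γ (A ⊗ B)
    fst  : ∀ {A B} → Tm Γ (A ⊗ B) → Tm Γ A
    snd  : ∀ {A B} → Tm Γ (A ⊗ B) → Tm Γ B
    app  : ∀ {A B} → Tm Γ (A ⇛ B) → Tm Γ A → Tm Γ B
    lam  : ∀ {A B} → Tm (Γ ▸ A) B → Tm Γ (A ⇛ B)

  data Pol : Set where
    neg⁻ dinΔ pos⁺ : Pol

  data Quant : Set where
    ∃q ∀q : Quant

  extN : Pol → Type → Ctx → Ctx
  extN neg⁻ A Θ = Θ ▸ A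
  extN dinΔ A Θ = Θ
  extN pos⁺ A Θ = Θ

  extD : Pol → Type → Ctx → Ctx
  extD neg⁻ A Δ = Δ
  extD dinΔ A Δ = Δ ▸ A
  extD pos⁺ A Δ = Δ

  extP : Pol → Type → Ctx → Ctx
  extP neg⁻ A Γ = Γ
  extP dinΔ A Γ = Γ
  extP pos⁺ A Γ = Γ ▸ A

  data Fm : Ctx → Ctx → Ctx → Set where
    ⊤′   : ∀ {Θ Δ Γ} → Fm Θ Δ Γ
    _∧′_ : ∀ {Θ Δ Γ} → Fm Θ Δ Γ → Fm Θ Δ Γ → Fm Θ Δ Γ
    _⇒′_ : ∀ {Θ Δ Γ} → Fm Γ Δ Θ → Fm Θ Δ Γ → Fm Θ Δ Γ
    leq  : ∀ {Θ Δ Γ} (A : Type) → Tm (Θ ++ Δ) A → Tm (Γ ++ Δ) A → Fm Θ Δ Γ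
    prd  : ∀ {Θ Δ Γ} (P : Pred) → Tm (Θ ++ Δ) (neg P) → Tm (Γ ++ Δ) (pos P) → Fm Θ Δ Γ
    qnt  : ∀ {Θ Δ Γ} (q : Quant) (p : Pol) (A : Type) →
           Fm (extN p A Θ) (extD p A Δ) (extP p A Γ) → Fm Θ Δ Γ

  Ren : Ctx → Ctx → Set
  Ren Γ Γ′ = ∀ {A} → Γ ∋ A → Γ′ ∋ A

  lift : ∀ {Γ Γ′ B} → Ren Γ Γ′ → Ren (Γ ▸ B) (Γ′ ▸ B)
  lift ρ ze     = ze
  lift ρ (su x) = su (ρ x)

  renTm : ∀ {Γ Γ′ A} → Ren Γ Γ′ → Tm Γ A → Tm Γ′ A
  renTm ρ (var x)    = var (ρ x)
  renTm ρ (fun f t)  = fun f (renTm ρ t)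
  renTm ρ !          = !
  renTm ρ (pair s t) = pair (renTm ρ s) (renTm ρ t)
  renTm ρ (fst t)    = fst (renTm ρ t)
  renTm ρ (snd t)    = snd (renTm ρ t)
  renTm ρ (app s t)  = app (renTm ρ s) (renTm ρ t)
  renTm ρ (lam t)    = lam (renTm (lift ρ) t)

  inl : ∀ {Θ} Δ {A} → Θ ∋ A → (Θ ++ Δ) ∋ A
  inl ∙       x = x
  inl (Δ ▸ B) x = su (inl Δ x)

  inr : ∀ {Θ Δ A} → Δ ∋ A → (Θ ++ Δ) ∋ A
  inr ze     = ze
  inr (su x) = su (inr x)

  split : ∀ {Θ} Δ {A} → (Θ ++ Δ) ∋ A → (Θ ∋ A) ⊎ (Δ ∋ A)
  split ∙       x      = inj₁ x
  split (Δ ▸ B) ze     = inj₂ ze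
  split (Δ ▸ B) (su x) = map id su (split Δ x)

  record PRen (Θ Δ Γ Θ′ Δ′ Γ′ : Ctx) : Set where
    field
      rN : ∀ {A} → Θ ∋ A → (Θ′ ∋ A) ⊎ (Δ′ ∋ A)
      rD : ∀ {A} → Δ ∋ A → Δ′ ∋ A
      rP : ∀ {A} → Γ ∋ A → (Γ′ ∋ A) ⊎ (Δ′ ∋ A)
  open PRen

  sideRen : ∀ {X Δ X′ Δ′} → (∀ {A} → X ∋ A → (X′ ∋ A) ⊎ (Δ′ ∋ A)) →
            (∀ {A} → Δ ∋ A → Δ′ ∋ A) → Ren (X ++ Δ) (X′ ++ Δ′)
  sideRen {X} {Δ} {X′} {Δ′} r d x with split Δ x
  ... | inj₁ y = [ inl Δ′ , inr ] (r y)
  ... | inj₂ z = inr (d z)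

  swapR : ∀ {Θ Δ Γ Θ′ Δ′ Γ′} → PRen Θ Δ Γ Θ′ Δ′ Γ′ → PRen Γ Δ Θ Γ′ Δ′ Θ′
  swapR ρ = record { rN = rP ρ ; rD = rD ρ ; rP = rN ρ }

  extR : ∀ {Θ Δ Γ Θ′ Δ′ Γ′} (p : Pol) (A : Type) → PRen Θ Δ Γ Θ′ Δ′ Γ′ →
         PRen (extN p A Θ) (extD p A Δ) (extP p A Γ)
              (extN p A Θ′) (extD p A Δ′) (extP p A Γ′)
  extR neg⁻ A ρ = record
    { rN = λ { ze → inj₁ ze ; (su x) → map su id (rN ρ x) }
    ; rD = rD ρ ; rP = rP ρ }
  extR dinΔ A ρ = record
    { rN = λ x → map id su (rN ρ x)
    ; rD = lift (rD ρ)
    ; rP = λ x → map id su (rP ρ x) }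
  extR pos⁺ A ρ = record
    { rN = rN ρ ; rD = rD ρ
    ; rP = λ { ze → inj₁ ze ; (su x) → map su id (rP ρ x) } }

  renFm : ∀ {Θ Δ Γ Θ′ Δ′ Γ′} → PRen Θ Δ Γ Θ′ Δ′ Γ′ → Fm Θ Δ Γ → Fm Θ′ Δ′ Γ′
  renFm ρ ⊤′          = ⊤′
  renFm ρ (φ ∧′ ψ)    = renFm ρ φ ∧′ renFm ρ ψ
  renFm ρ (ψ ⇒′ φ)    = renFm (swapR ρ) ψ ⇒′ renFm ρ φ
  renFm ρ (leq A s t) = leq A (renTm (sideRen (rN ρ) (rD ρ)) s) (renTm (sideRen (rP ρ) (rD ρ)) t)
  renFm ρ (prd P s t) = prd P (renTm (sideRen (rN ρ) (rD ρ)) s) (renTm (sideRen (rP ρ) (rD ρ)) t)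
  renFm ρ (qnt q p A φ) = qnt q p A (renFm (extR p A ρ) φ)

  -- The full dinatural collapse  [Θ,Δ₁ | • | Γ,Δ₂] → [Θ | Δ | Γ]:
  -- Θ ↦ Θ, Γ ↦ Γ, and both copies Δ₁, Δ₂ of Δ ↦ Δ.
  collapseRen : ∀ Θ Δ Γ → PRen (Θ ++ Δ) ∙ (Γ ++ Δ) Θ Δ Γ
  collapseRen Θ Δ Γ = record
    { rN = split Δ
    ; rD = λ ()
    ; rP = split Δ }

  collapse : ∀ Θ Δ Γ → Fm (Θ ++ Δ) ∙ (Γ ++ Δ) → Fm Θ Δ Γ
  collapse Θ Δ Γ = renFm (collapseRen Θ Δ Γ)

{-# OPTIONS --safe #-}
module Submission where

-- A polarized renaming ρ acts on an atom by renaming its negative term along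
-- the induced renaming of Θ,Δ and its positive term along that of Γ,Δ.  If both
-- sides of ρ, viewed as maps Θ ⊎ Δ → Θ′ ⊎ Δ′ and Γ ⊎ Δ → Γ′ ⊎ Δ′ on variables,
-- are bijective, then so are these term renamings, and this survives swapping
-- the sides (left of an implication) and binding a variable of any polarity.
-- Renaming every atom backwards therefore inverts renFm ρ, although the inverse
-- is not itself a polarized renaming: it must send a dinatural variable to a
-- negative and to a positive one.  The full collapse is such a ρ, each of its
-- sides being the canonical bijection between the variables of Θ,Δ and Θ ⊎ Δ.

open import Data.Product using (_×_; _,_; swap)
open import Data.Sum using (_⊎_; inj₁; inj₂; [_,_]; map)
open import Function using (_∘_; id)
open import Function.Bundles using (_↔_; mk↔ₛ′; Bijection)
open import Function.Definitions using (Bijective)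
open import Function.Properties.Inverse using (Inverse⇒Bijection)
open import Relation.Binary.PropositionalEquality
  using (_≡_; refl; sym; trans; cong; cong₂; module ≡-Reasoning)

open import Defs hiding (_∋_; _++_)

module _ (T : Theory) where
  open PRen
  open ≡-Reasoning

  private
    infix  4 _∋_
    infixl 5 _++_

    _∋_ : Ctx T → Type T → Set
    _∋_ = Defs._∋_ T

    _++_ : Ctx T → Ctx T → Ctx T
    _++_ = Defs._++_ T

  variable
    Θ Δ Γ Θ′ Δ′ Γ′ X X′ D D′ Y : Ctx T
    A B : Type T

  record Invertible {P Q : Type T → Set} (f : ∀ {A} → P A → Q A) : Set where
    field
      from     : ∀ {A} → Q A → P A
      inverseˡ : ∀ {A} (y : Q A) → f {A} (from y) ≡ y
      inverseʳ : ∀ {A} (x : P A) → from {A} (f x) ≡ x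
  open Invertible

  Invertible-resp : {P Q : Type T → Set} {f g : ∀ {A} → P A → Q A} →
                    (∀ {A} (x : P A) → f {A} x ≡ g x) → Invertible f → Invertible g
  Invertible-resp f≗g I = record
    { from     = from I
    ; inverseˡ = λ {A} y → trans (sym (f≗g {A} (from I y))) (inverseˡ I y)
    ; inverseʳ = λ {A} x → trans (cong (from I {A}) (sym (f≗g x))) (inverseʳ I x)
    }

  Invertible-∘ : {P Q R : Type T → Set} {f : ∀ {A} → P A → Q A} {g : ∀ {A} → Q A → R A} →
                 Invertible f → Invertible g → Invertible (λ {A} x → g {A} (f {A} x))
  Invertible-∘ {f = f} {g} F G = record
    { from     = λ {A} z → from F {A} (from G {A} z)
    ; inverseˡ = λ {A} z → trans (cong (g {A}) (inverseˡ F (from G {A} z))) (inverseˡ G z)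
    ; inverseʳ = λ {A} x → trans (cong (from F {A}) (inverseʳ G (f {A} x))) (inverseʳ F x)
    }

  weakenˡ : X ∋ A ⊎ D ∋ A → X ▸ B ∋ A ⊎ D ∋ A
  weakenˡ = map su id

  weakenʳ : X ∋ A ⊎ D ∋ A → X ∋ A ⊎ D ▸ B ∋ A
  weakenʳ = map id su

  unsplit : ∀ D {A} → X ∋ A ⊎ D ∋ A → X ++ D ∋ A
  unsplit D = [ inl T D , inr T ]

  split-inl : ∀ D (x : X ∋ A) → split T D (inl T D x) ≡ inj₁ x
  split-inl ∙       x = refl
  split-inl (D ▸ B) x = cong weakenʳ (split-inl D x)

  split-inr : ∀ D (x : D ∋ A) → split T {X} D (inr T x) ≡ inj₂ x
  split-inr (D ▸ B) ze     = refl
  split-inr (D ▸ B) (su x) = cong weakenʳ (split-inr D x)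

  split-unsplit : ∀ D (s : X ∋ A ⊎ D ∋ A) → split T D (unsplit D s) ≡ s
  split-unsplit D (inj₁ x) = split-inl D x
  split-unsplit D (inj₂ x) = split-inr D x

  unsplit-split : ∀ D (x : X ++ D ∋ A) → unsplit D (split T D x) ≡ x
  unsplit-split ∙       x      = refl
  unsplit-split (D ▸ B) ze     = refl
  unsplit-split (D ▸ B) (su x) with split T D x | unsplit-split D x
  ... | inj₁ y | eq = cong su eq
  ... | inj₂ z | eq = cong su eq

  split-invertible : ∀ D → Invertible (λ {A} → split T {X} D {A})
  split-invertible D = record
    { from = unsplit D ; inverseˡ = split-unsplit D ; inverseʳ = unsplit-split D }

  unsplit-invertible : ∀ D → Invertible (λ {A} → unsplit {X} D {A})
  unsplit-invertible D = record
    { from = split T D ; inverseˡ = unsplit-split D ; inverseʳ = split-unsplit D }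

  side : (∀ {A} → X ∋ A → X′ ∋ A ⊎ D′ ∋ A) → Ren T D D′ → X ∋ A ⊎ D ∋ A → X′ ∋ A ⊎ D′ ∋ A
  side r d = [ r , inj₂ ∘ d ]

  sideRen-split : (r : ∀ {A} → X ∋ A → X′ ∋ A ⊎ D′ ∋ A) (d : Ren T D D′) (x : X ++ D ∋ A) →
                  sideRen T r d x ≡ unsplit D′ (side r d (split T D x))
  sideRen-split {D = D} r d x with split T D x
  ... | inj₁ y = refl
  ... | inj₂ z = refl

  sideRen-invertible : (r : ∀ {A} → X ∋ A → X′ ∋ A ⊎ D′ ∋ A) (d : Ren T D D′) →
                       Invertible (side r d) → Invertible (sideRen T r d)
  sideRen-invertible {D′ = D′} {D = D} r d I =
    Invertible-resp (λ x → sym (sideRen-split r d x))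
      (Invertible-∘ (split-invertible D) (Invertible-∘ I (unsplit-invertible D′)))

  lift-inverseʳ : {ρ : Ren T X Y} {σ : Ren T Y X} → (∀ {A} (x : X ∋ A) → σ (ρ x) ≡ x) →
                  ∀ {A} (x : X ▸ B ∋ A) → lift T σ (lift T ρ x) ≡ x
  lift-inverseʳ σρ ze     = refl
  lift-inverseʳ σρ (su x) = cong su (σρ x)

  renTm-inverseʳ : {ρ : Ren T X Y} {σ : Ren T Y X} → (∀ {A} (x : X ∋ A) → σ (ρ x) ≡ x) →
                   (t : Tm T X A) → renTm T σ (renTm T ρ t) ≡ t
  renTm-inverseʳ σρ (var x)    = cong var (σρ x)
  renTm-inverseʳ σρ (fun f t)  = cong (fun f) (renTm-inverseʳ σρ t)
  renTm-inverseʳ σρ !          = refl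
  renTm-inverseʳ σρ (pair s t) = cong₂ pair (renTm-inverseʳ σρ s) (renTm-inverseʳ σρ t)
  renTm-inverseʳ σρ (fst t)    = cong fst (renTm-inverseʳ σρ t)
  renTm-inverseʳ σρ (snd t)    = cong snd (renTm-inverseʳ σρ t)
  renTm-inverseʳ σρ (app s t)  = cong₂ app (renTm-inverseʳ σρ s) (renTm-inverseʳ σρ t)
  renTm-inverseʳ σρ (lam t)    = cong lam (renTm-inverseʳ (lift-inverseʳ σρ) t)

  renTm-invertible : {ρ : Ren T X Y} →
                     Invertible (λ {A} → ρ {A}) → Invertible (λ {A} → renTm T {A = A} ρ)
  renTm-invertible I = record
    { from     = λ {A} → renTm T {A = A} (from I)
    ; inverseˡ = renTm-inverseʳ (inverseˡ I)
    ; inverseʳ = renTm-inverseʳ (inverseʳ I)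
    }

  negSide : PRen T Θ Δ Γ Θ′ Δ′ Γ′ → ∀ {A} → Θ ∋ A ⊎ Δ ∋ A → Θ′ ∋ A ⊎ Δ′ ∋ A
  negSide ρ = side (rN ρ) (rD ρ)

  posSide : PRen T Θ Δ Γ Θ′ Δ′ Γ′ → ∀ {A} → Γ ∋ A ⊎ Δ ∋ A → Γ′ ∋ A ⊎ Δ′ ∋ A
  posSide ρ = side (rP ρ) (rD ρ)

  SidesInvertible : PRen T Θ Δ Γ Θ′ Δ′ Γ′ → Set
  SidesInvertible ρ = Invertible (λ {A} → negSide ρ {A}) × Invertible (λ {A} → posSide ρ {A})

  ▸ˡ-invertible : {F : ∀ {A} → X ∋ A ⊎ D ∋ A → X′ ∋ A ⊎ D′ ∋ A}
                  {F′ : ∀ {A} → X ▸ B ∋ A ⊎ D ∋ A → X′ ▸ B ∋ A ⊎ D′ ∋ A} →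
                  F′ (inj₁ ze) ≡ inj₁ ze →
                  (∀ {A} (s : X ∋ A ⊎ D ∋ A) → F′ (weakenˡ s) ≡ weakenˡ (F s)) →
                  Invertible (λ {A} → F {A}) → Invertible (λ {A} → F′ {A})
  ▸ˡ-invertible {X = X} {D = D} {X′ = X′} {D′ = D′} {B = B} {F = F} {F′} fresh commute I =
    record { from = from′ ; inverseˡ = inverseˡ′ ; inverseʳ = inverseʳ′ }
    where
    from′ : ∀ {A} → X′ ▸ B ∋ A ⊎ D′ ∋ A → X ▸ B ∋ A ⊎ D ∋ A
    from′ (inj₁ ze)     = inj₁ ze
    from′ (inj₁ (su x)) = weakenˡ (from I (inj₁ x))
    from′ (inj₂ d)      = weakenˡ (from I (inj₂ d))

    from′-weakenˡ : ∀ {A} (s : X′ ∋ A ⊎ D′ ∋ A) → from′ (weakenˡ s) ≡ weakenˡ (from I s)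
    from′-weakenˡ (inj₁ x) = refl
    from′-weakenˡ (inj₂ d) = refl

    inverseˡ-weakenˡ : ∀ {A} (s : X′ ∋ A ⊎ D′ ∋ A) → F′ (from′ (weakenˡ s)) ≡ weakenˡ s
    inverseˡ-weakenˡ s = begin
      F′ (from′ (weakenˡ s))    ≡⟨ cong F′ (from′-weakenˡ s) ⟩
      F′ (weakenˡ (from I s))   ≡⟨ commute (from I s) ⟩
      weakenˡ (F (from I s))    ≡⟨ cong weakenˡ (inverseˡ I s) ⟩
      weakenˡ s                 ∎

    inverseʳ-weakenˡ : ∀ {A} (s : X ∋ A ⊎ D ∋ A) → from′ (F′ (weakenˡ s)) ≡ weakenˡ s
    inverseʳ-weakenˡ s = begin
      from′ (F′ (weakenˡ s))    ≡⟨ cong from′ (commute s) ⟩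
      from′ (weakenˡ (F s))     ≡⟨ from′-weakenˡ (F s) ⟩
      weakenˡ (from I (F s))    ≡⟨ cong weakenˡ (inverseʳ I s) ⟩
      weakenˡ s                 ∎

    inverseˡ′ : ∀ {A} (s : X′ ▸ B ∋ A ⊎ D′ ∋ A) → F′ (from′ s) ≡ s
    inverseˡ′ (inj₁ ze)     = fresh
    inverseˡ′ (inj₁ (su x)) = inverseˡ-weakenˡ (inj₁ x)
    inverseˡ′ (inj₂ d)      = inverseˡ-weakenˡ (inj₂ d)

    inverseʳ′ : ∀ {A} (s : X ▸ B ∋ A ⊎ D ∋ A) → from′ (F′ s) ≡ s
    inverseʳ′ (inj₁ ze)     = cong from′ fresh
    inverseʳ′ (inj₁ (su x)) = inverseʳ-weakenˡ (inj₁ x)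
    inverseʳ′ (inj₂ d)      = inverseʳ-weakenˡ (inj₂ d)

  ▸ʳ-invertible : {F : ∀ {A} → X ∋ A ⊎ D ∋ A → X′ ∋ A ⊎ D′ ∋ A}
                  {F′ : ∀ {A} → X ∋ A ⊎ D ▸ B ∋ A → X′ ∋ A ⊎ D′ ▸ B ∋ A} →
                  F′ (inj₂ ze) ≡ inj₂ ze →
                  (∀ {A} (s : X ∋ A ⊎ D ∋ A) → F′ (weakenʳ s) ≡ weakenʳ (F s)) →
                  Invertible (λ {A} → F {A}) → Invertible (λ {A} → F′ {A})
  ▸ʳ-invertible {X = X} {D = D} {X′ = X′} {D′ = D′} {B = B} {F = F} {F′} fresh commute I =
    record { from = from′ ; inverseˡ = inverseˡ′ ; inverseʳ = inverseʳ′ }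
    where
    from′ : ∀ {A} → X′ ∋ A ⊎ D′ ▸ B ∋ A → X ∋ A ⊎ D ▸ B ∋ A
    from′ (inj₂ ze)     = inj₂ ze
    from′ (inj₂ (su d)) = weakenʳ (from I (inj₂ d))
    from′ (inj₁ x)      = weakenʳ (from I (inj₁ x))

    from′-weakenʳ : ∀ {A} (s : X′ ∋ A ⊎ D′ ∋ A) → from′ (weakenʳ s) ≡ weakenʳ (from I s)
    from′-weakenʳ (inj₁ x) = refl
    from′-weakenʳ (inj₂ d) = refl

    inverseˡ-weakenʳ : ∀ {A} (s : X′ ∋ A ⊎ D′ ∋ A) → F′ (from′ (weakenʳ s)) ≡ weakenʳ s
    inverseˡ-weakenʳ s = begin
      F′ (from′ (weakenʳ s))    ≡⟨ cong F′ (from′-weakenʳ s) ⟩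
      F′ (weakenʳ (from I s))   ≡⟨ commute (from I s) ⟩
      weakenʳ (F (from I s))    ≡⟨ cong weakenʳ (inverseˡ I s) ⟩
      weakenʳ s                 ∎

    inverseʳ-weakenʳ : ∀ {A} (s : X ∋ A ⊎ D ∋ A) → from′ (F′ (weakenʳ s)) ≡ weakenʳ s
    inverseʳ-weakenʳ s = begin
      from′ (F′ (weakenʳ s))    ≡⟨ cong from′ (commute s) ⟩
      from′ (weakenʳ (F s))     ≡⟨ from′-weakenʳ (F s) ⟩
      weakenʳ (from I (F s))    ≡⟨ cong weakenʳ (inverseʳ I s) ⟩
      weakenʳ s                 ∎

    inverseˡ′ : ∀ {A} (s : X′ ∋ A ⊎ D′ ▸ B ∋ A) → F′ (from′ s) ≡ s
    inverseˡ′ (inj₂ ze)     = fresh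
    inverseˡ′ (inj₂ (su d)) = inverseˡ-weakenʳ (inj₂ d)
    inverseˡ′ (inj₁ x)      = inverseˡ-weakenʳ (inj₁ x)

    inverseʳ′ : ∀ {A} (s : X ∋ A ⊎ D ▸ B ∋ A) → from′ (F′ s) ≡ s
    inverseʳ′ (inj₂ ze)     = cong from′ fresh
    inverseʳ′ (inj₂ (su d)) = inverseʳ-weakenʳ (inj₂ d)
    inverseʳ′ (inj₁ x)      = inverseʳ-weakenʳ (inj₁ x)

  extR-sidesInvertible : ∀ p B {ρ : PRen T Θ Δ Γ Θ′ Δ′ Γ′} →
                         SidesInvertible ρ → SidesInvertible (extR T p B ρ)
  extR-sidesInvertible neg⁻ B (N , P) =
    ▸ˡ-invertible refl (λ { (inj₁ _) → refl ; (inj₂ _) → refl }) N , P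
  extR-sidesInvertible dinΔ B (N , P) =
    ▸ʳ-invertible refl (λ { (inj₁ _) → refl ; (inj₂ _) → refl }) N ,
    ▸ʳ-invertible refl (λ { (inj₁ _) → refl ; (inj₂ _) → refl }) P
  extR-sidesInvertible pos⁺ B (N , P) =
    N , ▸ˡ-invertible refl (λ { (inj₁ _) → refl ; (inj₂ _) → refl }) P

  negTm-invertible : {ρ : PRen T Θ Δ Γ Θ′ Δ′ Γ′} → SidesInvertible ρ →
                     Invertible (λ {A} → renTm T {A = A} (sideRen T (rN ρ) (rD ρ)))
  negTm-invertible {ρ = ρ} (N , _) = renTm-invertible (sideRen-invertible (rN ρ) (rD ρ) N)

  posTm-invertible : {ρ : PRen T Θ Δ Γ Θ′ Δ′ Γ′} → SidesInvertible ρ →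
                     Invertible (λ {A} → renTm T {A = A} (sideRen T (rP ρ) (rD ρ)))
  posTm-invertible {ρ = ρ} (_ , P) = renTm-invertible (sideRen-invertible (rP ρ) (rD ρ) P)

  renFm⁻¹ : (ρ : PRen T Θ Δ Γ Θ′ Δ′ Γ′) → SidesInvertible ρ → Fm T Θ′ Δ′ Γ′ → Fm T Θ Δ Γ
  renFm⁻¹ ρ I ⊤′            = ⊤′
  renFm⁻¹ ρ I (φ ∧′ ψ)      = renFm⁻¹ ρ I φ ∧′ renFm⁻¹ ρ I ψ
  renFm⁻¹ ρ I (ψ ⇒′ φ)      = renFm⁻¹ (swapR T ρ) (swap I) ψ ⇒′ renFm⁻¹ ρ I φ
  renFm⁻¹ ρ I (leq A s t)   = leq A (from (negTm-invertible I) s) (from (posTm-invertible I) t)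
  renFm⁻¹ ρ I (prd P s t)   = prd P (from (negTm-invertible I) s) (from (posTm-invertible I) t)
  renFm⁻¹ ρ I (qnt q p A φ) = qnt q p A (renFm⁻¹ (extR T p A ρ) (extR-sidesInvertible p A I) φ)

  renFm-renFm⁻¹ : (ρ : PRen T Θ Δ Γ Θ′ Δ′ Γ′) (I : SidesInvertible ρ) (φ : Fm T Θ′ Δ′ Γ′) →
                  renFm T ρ (renFm⁻¹ ρ I φ) ≡ φ
  renFm-renFm⁻¹ ρ I ⊤′            = refl
  renFm-renFm⁻¹ ρ I (φ ∧′ ψ)      = cong₂ _∧′_ (renFm-renFm⁻¹ ρ I φ) (renFm-renFm⁻¹ ρ I ψ)
  renFm-renFm⁻¹ ρ I (ψ ⇒′ φ)      =
    cong₂ _⇒′_ (renFm-renFm⁻¹ (swapR T ρ) (swap I) ψ) (renFm-renFm⁻¹ ρ I φ)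
  renFm-renFm⁻¹ ρ I (leq A s t)   =
    cong₂ (leq A) (inverseˡ (negTm-invertible I) s) (inverseˡ (posTm-invertible I) t)
  renFm-renFm⁻¹ ρ I (prd P s t)   =
    cong₂ (prd P) (inverseˡ (negTm-invertible I) s) (inverseˡ (posTm-invertible I) t)
  renFm-renFm⁻¹ ρ I (qnt q p A φ) =
    cong (qnt q p A) (renFm-renFm⁻¹ (extR T p A ρ) (extR-sidesInvertible p A I) φ)

  renFm⁻¹-renFm : (ρ : PRen T Θ Δ Γ Θ′ Δ′ Γ′) (I : SidesInvertible ρ) (φ : Fm T Θ Δ Γ) →
                  renFm⁻¹ ρ I (renFm T ρ φ) ≡ φ
  renFm⁻¹-renFm ρ I ⊤′            = refl
  renFm⁻¹-renFm ρ I (φ ∧′ ψ)      = cong₂ _∧′_ (renFm⁻¹-renFm ρ I φ) (renFm⁻¹-renFm ρ I ψ)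
  renFm⁻¹-renFm ρ I (ψ ⇒′ φ)      =
    cong₂ _⇒′_ (renFm⁻¹-renFm (swapR T ρ) (swap I) ψ) (renFm⁻¹-renFm ρ I φ)
  renFm⁻¹-renFm ρ I (leq A s t)   =
    cong₂ (leq A) (inverseʳ (negTm-invertible I) s) (inverseʳ (posTm-invertible I) t)
  renFm⁻¹-renFm ρ I (prd P s t)   =
    cong₂ (prd P) (inverseʳ (negTm-invertible I) s) (inverseʳ (posTm-invertible I) t)
  renFm⁻¹-renFm ρ I (qnt q p A φ) =
    cong (qnt q p A) (renFm⁻¹-renFm (extR T p A ρ) (extR-sidesInvertible p A I) φ)

  renFm-↔ : (ρ : PRen T Θ Δ Γ Θ′ Δ′ Γ′) → SidesInvertible ρ → Fm T Θ Δ Γ ↔ Fm T Θ′ Δ′ Γ′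
  renFm-↔ ρ I = mk↔ₛ′ (renFm T ρ) (renFm⁻¹ ρ I) (renFm-renFm⁻¹ ρ I) (renFm⁻¹-renFm ρ I)

  split-side-invertible : ∀ D (none : Ren T ∙ D) →
                          Invertible (λ {A} → side {A = A} (split T {X} D) none)
  split-side-invertible D _ = record
    { from     = inj₁ ∘ unsplit D
    ; inverseˡ = split-unsplit D
    ; inverseʳ = λ { (inj₁ x) → cong inj₁ (unsplit-split D x) ; (inj₂ ()) }
    }

  collapseRen-sidesInvertible : ∀ Θ Δ Γ → SidesInvertible (collapseRen T Θ Δ Γ)
  collapseRen-sidesInvertible Θ Δ Γ = split-side-invertible Δ _ , split-side-invertible Δ _

mainTheorem2 : (T : Theory) (Θ Δ Γ : Ctx T) →
    Bijective _≡_ _≡_ (collapse T Θ Δ Γ)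
mainTheorem2 T Θ Δ Γ =
  Bijection.bijective (Inverse⇒Bijection
    (renFm-↔ T (collapseRen T Θ Δ Γ) (collapseRen-sidesInvertible T Θ Δ Γ)))
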